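{- Let $V=(v_1,\dots,v_n)$ be a finite sequence of points in the tropical torus $\mathbb{T}^{d-1}=\mathbb{R}^d/\mathbb{R}\mathbf{1}_d$, and let $k\in[d]$. Define the $k$-th corner \[ c_k(V) \ := \ (-v_{1,k})\odot v_1 \oplus (-v_{2,k})\odot v_2 \oplus \dots \oplus (-v_{n,k})\odot v_n , \] i.e. the class of the componentwise minimum of the vectors $v_i - v_{i,k}\mathbf{1}_d$, $i\in[n]$ (here $v_{i,j}$ is the $j$-th coordinate of a representative of $v_i$). Then the closed tropical halfspace $c_k(V)+\bar S_k$ contains $\operatorname{tconv} V$ and is minimal with respect to inclusion among all closed tropical halfspaces containing $\operatorname{tconv} V$.
   Context: Tropical semiring: $\oplus=\min$, $\odot=+$. $\mathbf{1}_d=(1,\dots,1)\in\mathbb{R}^d$. Tropical scalar multiplication $\lambda\odot v$ means $v+\lambda\mathbf{1}_d$, and $\oplus$ of vectors is componentwise minimum; these are well defined on $\mathbb{T}^{d-1}$. For $V\subset\mathbb{T}^{d-1}$ finite, $\operatorname{tconv} V$ is the smallest subset of $\mathbb{T}^{d-1}$ containing $V$ and closed under $(x,y)\mapsto \lambda\odot x\oplus\mu\odot y$ for all $\lambda,\mu\in\mathbb{R}$ (equivalently, the set of all tropical linear combinations $\bigoplus_i \lambda_i\odot v_i$). For $x\in\mathbb{T}^{d-1}$ let $x^0=x-\min(x_1,\dots,x_d)\mathbf{1}_d$. The closed sectors are $\bar S_i=\{x\in\mathbb{T}^{d-1}: x^0_i=0\}$ for $i\in[d]$. For $a\in\mathbb{T}^{d-1}$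 and $\emptyset\neq H\subsetneq[d]$, the closed tropical halfspace with apex $a$ is $(a,H):=a+\bigcup_{i\in H}\bar S_i$; a closed tropical halfspace is any set of this form. -}

module Defs where

open import Data.Nat using (ℕ; suc)
open import Data.Fin using (Fin; zero; suc)
open import Data.Fin.Subset using (Subset; _∈_; ⊤; Nonempty)
open import Data.Product using (Σ; ∃; _×_; _,_)
open import Data.Sum using (_⊎_; [_,_])
open import Data.Empty using (⊥)
open import Relation.Nullary using (¬_)
open import Relation.Binary.PropositionalEquality using (_≡_; _≢_)
open import Algebra.Structures using (IsCommutativeRing)
open import Relation.Binary.Structures using (IsTotalOrder)

-- Classically every such structure is isomorphic to ℝ, so quantifying over
-- all of them is a faithful stand-in for "the real numbers".
record RealField : Set₁ where
  infixl 6 _+_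
  infixl 7 _*_
  infix 4 _≤_
  field
    Carrier : Set
    _+_ _*_ : Carrier → Carrier → Carrier
    -_ : Carrier → Carrier
    0# 1# : Carrier
    _≤_ : Carrier → Carrier → Set
    isCommutativeRing : IsCommutativeRing _≡_ _+_ _*_ -_ 0# 1#
    0≢1 : 0# ≢ 1#
    inverse : ∀ x → x ≢ 0# → ∃ λ y → x * y ≡ 1#
    isTotalOrder : IsTotalOrder _≡_ _≤_
    +-mono-≤ : ∀ x y z → x ≤ y → x + z ≤ y + z
    *-nonneg : ∀ x y → 0# ≤ x → 0# ≤ y → 0# ≤ x * y
    complete : (S : Carrier → Set) → ∃ S → (∃ λ b → ∀ x → S x → x ≤ b) →
               ∃ λ s → (∀ x → S x → x ≤ s) × (∀ b → (∀ x → S x → x ≤ b) → s ≤ b)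

module Tropical (F : RealField) where
  open RealField F

  _-_ : Carrier → Carrier → Carrier
  x - y = x + (- y)

  _⊓_ : Carrier → Carrier → Carrier
  x ⊓ y = [ (λ _ → x) , (λ _ → y) ] (IsTotalOrder.total isTotalOrder x y)

  minF : ∀ {m} → (Fin (suc m) → Carrier) → Carrier
  minF {ℕ.zero} f = f zero
  minF {suc m} f = f zero ⊓ minF (λ i → f (suc i))

  -- representatives of points of the tropical torus T^{d-1} = ℝ^d / ℝ𝟏
  Pt : ℕ → Set
  Pt d = Fin d → Carrier

  _~_ : ∀ {d} → Pt d → Pt d → Set
  x ~ y = ∃ λ c → ∀ i → x i ≡ y i + c

  _⊙_ : ∀ {d} → Carrier → Pt d → Pt d
  (λ' ⊙ v) i = v i + λ'

  _⊕_ : ∀ {d} → Pt d → Pt d → Pt d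
  (x ⊕ y) i = x i ⊓ y i

  ⨁ : ∀ {m d} → (Fin (suc m) → Pt d) → Pt d
  ⨁ f i = minF (λ j → f j i)

  PtSet : ℕ → Set₁
  PtSet d = Pt d → Set

  _⊆_ : ∀ {d} → PtSet d → PtSet d → Set
  A ⊆ B = ∀ x → A x → B x

  tconv : ∀ {n d} → (Fin (suc n) → Pt d) → PtSet d
  tconv V x = ∃ λ (lam : Fin _ → Carrier) → x ~ ⨁ (λ j → lam j ⊙ V j)

  normalize : ∀ {e} → Pt (suc e) → Pt (suc e)
  normalize x i = x i - minF x

  closedSector : ∀ {e} → Fin (suc e) → PtSet (suc e)
  closedSector i x = normalize x i ≡ 0#

  halfspace : ∀ {e} → Pt (suc e) → Subset (suc e) → PtSet (suc e)
  halfspace a H x = ∃ λ i → i ∈ H × closedSector i (λ j → x j - a j)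

  ProperNonempty : ∀ {d} → Subset d → Set
  ProperNonempty H = Nonempty H × H ≢ ⊤

  corner : ∀ {n d} → (Fin (suc n) → Pt d) → Fin d → Pt d
  corner V k = ⨁ (λ i → (- V i k) ⊙ V i)

-- The first step is
-- to trade the definition of closed sectors (x⁰_i = 0) for an additive
-- inequality: x lies in a + S̄_i iff x_i + a_j ≤ x_j + a_i for all j
-- (the relation `Below a i x` below).  With this description:
--
--  * containment: every tropical combination M = ⨁ λ_j ⊙ v_j satisfies
--    M_k + c_i ≤ M_i (because c_i ≤ v_{j,i} - v_{j,k} for every j), and
--    c_k = 0, so tconv V ⊆ c + S̄_k;
--  * minimality: a translated sector a + S̄_i is never contained in c + S̄_k
--    when i ≠ k (move a point of a + S̄_i arbitrarily far "away from i";
--    F has no largest element), so a halfspace (a, H) inside c + S̄_k has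
--    H = {k}; since c ∈ tconv V ⊆ a + S̄_k and the relation `Below · k` is
--    transitive, c + S̄_k ⊆ a + S̄_k.
module Submission where

open import Defs
open import Data.Nat using (ℕ; suc)
open import Data.Fin using (Fin)
open import Data.Fin.Subset using (Subset; ⁅_⁆)
open import Data.Product using (_×_)

open import Data.Fin using (_≟_)
open import Data.Fin.Subset using (_∈_; ⊤; ∣_∣)
open import Data.Fin.Subset.Properties using (x∈⁅x⁆; x∈⁅y⁆⇒x≡y; ∣⁅x⁆∣≡1; ∣⊤∣≡n)
open import Data.Product using (_,_)
open import Data.Sum using (inj₁; inj₂)
open import Data.Empty using (⊥-elim)
open import Relation.Nullary using (¬_; yes; no)
open import Relation.Binary.PropositionalEquality
  using (_≡_; _≢_; refl; sym; trans; cong; subst; subst₂)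
open import Level using (0ℓ)
open import Algebra.Bundles using (CommutativeRing)
open import Relation.Binary.Bundles using (Poset)
open import Relation.Binary.Structures using (IsTotalOrder)
import Algebra.Properties.CommutativeSemigroup as CommSemigroupProperties
import Algebra.Properties.Group as GroupProperties
import Algebra.Properties.Ring as RingProperties
import Relation.Binary.Reasoning.PartialOrder as ≤-Reasoning

module Halfspaces (F : RealField) where
  open RealField F
  open Tropical F
  open IsTotalOrder isTotalOrder using (total; antisym; isPartialOrder)
    renaming (refl to ≤-refl; trans to ≤-trans; reflexive to ≤-reflexive)

  commutativeRing : CommutativeRing 0ℓ 0ℓ
  commutativeRing = record { isCommutativeRing = isCommutativeRing }

  open CommutativeRing commutativeRing
    using (+-assoc; +-comm; +-identityˡ; +-identityʳ; -‿inverseʳ; +-commutativeSemigroup; +-group; ring)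
  open CommSemigroupProperties +-commutativeSemigroup using (interchange; xy∙z≈xz∙y; xy∙z≈zx∙y)
  open GroupProperties +-group using (\\-leftDividesʳ; //-rightDividesˡ; //-rightDividesʳ; ⁻¹-involutive)
  open RingProperties ring using (-1*x≈-x)

  poset : Poset 0ℓ 0ℓ 0ℓ
  poset = record { isPartialOrder = isPartialOrder }

  open ≤-Reasoning poset

  singleton-proper : ∀ {d} (k : Fin (suc (suc d))) → ProperNonempty ⁅ k ⁆
  singleton-proper {d} k = (k , x∈⁅x⁆ k) , λ ⁅k⁆≡⊤ → 1≢d+2 (sizes ⁅k⁆≡⊤)
    where
    1≢d+2 : 1 ≢ suc (suc d)
    1≢d+2 ()
    sizes : ⁅ k ⁆ ≡ ⊤ → 1 ≡ suc (suc d)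
    sizes ⁅k⁆≡⊤ = trans (sym (∣⁅x⁆∣≡1 k)) (trans (cong ∣_∣ ⁅k⁆≡⊤) (∣⊤∣≡n _))

  +-monoˡ : ∀ {a b} c → a ≤ b → a + c ≤ b + c
  +-monoˡ {a} {b} c = +-mono-≤ a b c

  +-monoʳ : ∀ {a b} c → a ≤ b → c + a ≤ c + b
  +-monoʳ {a} {b} c a≤b = subst₂ _≤_ (+-comm a c) (+-comm b c) (+-monoˡ c a≤b)

  +-mono : ∀ {a b c d} → a ≤ b → c ≤ d → a + c ≤ b + d
  +-mono {b = b} {c = c} a≤b c≤d = ≤-trans (+-monoˡ c a≤b) (+-monoʳ b c≤d)

  +-cancelʳ : ∀ {a b} c → a + c ≤ b + c → a ≤ b
  +-cancelʳ {a} {b} c a+c≤b+c = begin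
    a             ≈⟨ //-rightDividesʳ c a ⟨
    (a + c) - c   ≤⟨ +-monoˡ (- c) a+c≤b+c ⟩
    (b + c) - c   ≈⟨ //-rightDividesʳ c b ⟩
    b             ∎

  ≤-+-nonneg : ∀ u {t} → 0# ≤ t → u ≤ u + t
  ≤-+-nonneg u {t} 0≤t = subst (_≤ u + t) (+-identityʳ u) (+-monoʳ u 0≤t)

  ≤⇒0≤- : ∀ {u v} → u ≤ v → 0# ≤ v - u
  ≤⇒0≤- {u} {v} u≤v = subst (_≤ v - u) (-‿inverseʳ u) (+-monoˡ (- u) u≤v)

  -- In an ordered field 0 < 1: otherwise 0 ≤ -1, hence 0 ≤ (-1)(-1) = 1.
  0≤1 : 0# ≤ 1#
  0≤1 with total 0# 1#
  ... | inj₁ 0≤1 = 0≤1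
  ... | inj₂ 1≤0 = subst (0# ≤_) square (*-nonneg (- 1#) (- 1#) 0≤-1 0≤-1)
    where
    0≤-1 : 0# ≤ - 1#
    0≤-1 = subst₂ _≤_ (-‿inverseʳ 1#) (+-identityˡ (- 1#)) (+-monoˡ (- 1#) 1≤0)
    square : - 1# * - 1# ≡ 1#
    square = trans (-1*x≈-x (- 1#)) (⁻¹-involutive 1#)

  1≰0 : ¬ (1# ≤ 0#)
  1≰0 1≤0 = 0≢1 (antisym 0≤1 1≤0)

  -- F has no largest element: u + t ≤ v cannot hold for all t ≥ 0
  -- (take t = (v - u) + 1, which is ≥ 0 because already u + 0 ≤ v).
  unbounded : ∀ u v → ¬ (∀ t → 0# ≤ t → u + t ≤ v)
  unbounded u v bounded = 1≰0 (+-cancelʳ v (subst₂ _≤_ reach (sym (+-identityˡ v)) (bounded t 0≤t)))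
    where
    t : Carrier
    t = (v - u) + 1#
    0≤t : 0# ≤ t
    0≤t = subst (_≤ t) (+-identityʳ 0#)
            (+-mono (≤⇒0≤- (subst (_≤ v) (+-identityʳ u) (bounded 0# ≤-refl))) 0≤1)
    reach : u + t ≡ 1# + v
    reach = begin-equality
      u + ((v - u) + 1#)   ≈⟨ +-assoc u (v - u) 1# ⟨
      (u + (v - u)) + 1#   ≈⟨ cong (_+ 1#) (trans (+-comm u (v - u)) (//-rightDividesˡ u v)) ⟩
      v + 1#               ≈⟨ +-comm v 1# ⟩
      1# + v               ∎

  diff-≤⇒ : ∀ p q r s → p - q ≤ r - s → p + s ≤ r + q
  diff-≤⇒ p q r s ≤-diff = subst₂ _≤_ left right (+-monoˡ (q + s) ≤-diff)
    where
    left : (p - q) + (q + s) ≡ p + s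
    left = trans (+-assoc p (- q) (q + s)) (cong (p +_) (\\-leftDividesʳ q s))
    right : (r - s) + (q + s) ≡ r + q
    right = trans (cong ((r - s) +_) (+-comm q s))
              (trans (+-assoc r (- s) (s + q)) (cong (r +_) (\\-leftDividesʳ s q)))

  ⇒diff-≤ : ∀ p q r s → p + s ≤ r + q → p - q ≤ r - s
  ⇒diff-≤ p q r s ≤-sum = subst₂ _≤_ left right (+-monoˡ (- q + - s) ≤-sum)
    where
    left : (p + s) + (- q + - s) ≡ p - q
    left = trans (interchange p s (- q) (- s))
             (trans (cong ((p - q) +_) (-‿inverseʳ s)) (+-identityʳ (p - q)))
    right : (r + q) + (- q + - s) ≡ r - s
    right = trans (cong ((r + q) +_) (+-comm (- q) (- s)))
              (trans (interchange r q (- s) (- q)) (trans (cong ((r - s) +_) (-‿inverseʳ q)) (+-identityʳ (r - s))))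

  ⊓-lowerˡ : ∀ x y → x ⊓ y ≤ x
  ⊓-lowerˡ x y with total x y
  ... | inj₁ _   = ≤-refl
  ... | inj₂ y≤x = y≤x

  ⊓-lowerʳ : ∀ x y → x ⊓ y ≤ y
  ⊓-lowerʳ x y with total x y
  ... | inj₁ x≤y = x≤y
  ... | inj₂ _   = ≤-refl

  ⊓-greatest : ∀ {b} x y → b ≤ x → b ≤ y → b ≤ x ⊓ y
  ⊓-greatest x y b≤x b≤y with total x y
  ... | inj₁ _ = b≤x
  ... | inj₂ _ = b≤y

  minF-lower : ∀ {m} (f : Fin (suc m) → Carrier) j → minF f ≤ f j
  minF-lower {ℕ.zero} f Fin.zero    = ≤-refl
  minF-lower {suc m}  f Fin.zero    = ⊓-lowerˡ _ _
  minF-lower {suc m}  f (Fin.suc j) = ≤-trans (⊓-lowerʳ _ _) (minF-lower (λ i → f (Fin.suc i)) j)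

  minF-greatest : ∀ {m} (f : Fin (suc m) → Carrier) {b} → (∀ j → b ≤ f j) → b ≤ minF f
  minF-greatest {ℕ.zero} f b≤f = b≤f Fin.zero
  minF-greatest {suc m}  f b≤f =
    ⊓-greatest _ _ (b≤f Fin.zero) (minF-greatest (λ i → f (Fin.suc i)) (λ j → b≤f (Fin.suc j)))

  sector⇒minimal : ∀ {e} {y : Pt (suc e)} i → closedSector i y → ∀ j → y i ≤ y j
  sector⇒minimal {y = y} i y⁰ᵢ≡0 j = subst (_≤ y j) (sym yᵢ≡min) (minF-lower y j)
    where
    yᵢ≡min : y i ≡ minF y
    yᵢ≡min = GroupProperties.x∙y⁻¹≈ε⇒x≈y +-group (y i) (minF y) y⁰ᵢ≡0

  minimal⇒sector : ∀ {e} {y : Pt (suc e)} i → (∀ j → y i ≤ y j) → closedSector i y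
  minimal⇒sector {y = y} i yᵢ-min =
    GroupProperties.x≈y⇒x∙y⁻¹≈ε +-group (antisym (minF-greatest y yᵢ-min) (minF-lower y i))

  -- `Below a i x` says x ∈ a + S̄_i, written without subtraction.
  Below : ∀ {d} → Pt d → Fin d → Pt d → Set
  Below a i x = ∀ j → x i + a j ≤ x j + a i

  sector⇒Below : ∀ {e} {a x : Pt (suc e)} i → closedSector i (λ j → x j - a j) → Below a i x
  sector⇒Below {a = a} {x} i inSector j = diff-≤⇒ (x i) (a i) (x j) (a j) (sector⇒minimal i inSector j)

  Below⇒sector : ∀ {e} {a x : Pt (suc e)} i → Below a i x → closedSector i (λ j → x j - a j)
  Below⇒sector {a = a} {x} i below = minimal⇒sector i (λ j → ⇒diff-≤ (x i) (a i) (x j) (a j) (below j))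

  singleton⇒Below : ∀ {e} {a x : Pt (suc e)} i → halfspace a ⁅ i ⁆ x → Below a i x
  singleton⇒Below i (j , j∈⁅i⁆ , inSector) =
    subst (λ l → Below _ l _) (x∈⁅y⁆⇒x≡y i j∈⁅i⁆) (sector⇒Below j inSector)

  Below⇒halfspace : ∀ {e} {a x : Pt (suc e)} {H} i → i ∈ H → Below a i x → halfspace a H x
  Below⇒halfspace i i∈H below = i , i∈H , Below⇒sector i below

  -- If x ∈ c + S̄_k and c ∈ a + S̄_k then x ∈ a + S̄_k: add both
  -- inequalities and cancel c_j + c_k.
  Below-trans : ∀ {d} {a c x : Pt d} {k} → Below c k x → Below a k c → Below a k x
  Below-trans {a = a} {c} {x} {k} x-below c-below j = +-cancelʳ (c j + c k) (begin
    (x k + a j) + (c j + c k)   ≈⟨ interchange (x k) (c j) (a j) (c k) ⟨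
    (x k + c j) + (a j + c k)   ≈⟨ cong ((x k + c j) +_) (+-comm (a j) (c k)) ⟩
    (x k + c j) + (c k + a j)   ≤⟨ +-mono (x-below j) (c-below j) ⟩
    (x j + c k) + (c j + a k)   ≈⟨ cong ((x j + c k) +_) (+-comm (c j) (a k)) ⟩
    (x j + c k) + (a k + c j)   ≈⟨ interchange (x j) (c k) (a k) (c j) ⟩
    (x j + a k) + (c k + c j)   ≈⟨ cong ((x j + a k) +_) (+-comm (c k) (c j)) ⟩
    (x j + a k) + (c j + c k)   ∎)

  Below-shift : ∀ {d} {a x y : Pt d} {i} t → (∀ j → y j ≡ x j + t) → Below a i x → Below a i y
  Below-shift {a = a} {x} {y} {i} t y≡x+t below j = begin
    y i + a j         ≡⟨ cong (_+ a j) (y≡x+t i) ⟩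
    (x i + t) + a j   ≈⟨ xy∙z≈xz∙y (x i) t (a j) ⟩
    (x i + a j) + t   ≤⟨ +-monoˡ t (below j) ⟩
    (x j + a i) + t   ≈⟨ xy∙z≈xz∙y (x j) t (a i) ⟨
    (x j + t) + a i   ≡⟨ cong (_+ a i) (y≡x+t j) ⟨
    y j + a i         ∎

  raise : ∀ {d} → Pt d → Fin d → Carrier → Pt d
  raise a i t j with j ≟ i
  ... | yes _ = a j
  ... | no  _ = a j + t

  raise-at : ∀ {d} (a : Pt d) i t → raise a i t i ≡ a i
  raise-at a i t with i ≟ i
  ... | yes _ = refl
  ... | no i≢i = ⊥-elim (i≢i refl)

  raise-off : ∀ {d} (a : Pt d) {i j} t → j ≢ i → raise a i t j ≡ a j + t
  raise-off a {i} {j} t j≢i with j ≟ i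
  ... | yes j≡i = ⊥-elim (j≢i j≡i)
  ... | no _    = refl

  raise-Below : ∀ {d} (a : Pt d) i {t} → 0# ≤ t → Below a i (raise a i t)
  raise-Below a i {t} 0≤t j with j ≟ i
  ... | yes refl = ≤-reflexive (cong (_+ a i) (raise-at a i t))
  ... | no j≢i   = begin
    raise a i t i + a j   ≡⟨ cong (_+ a j) (raise-at a i t) ⟩
    a i + a j             ≤⟨ ≤-+-nonneg (a i + a j) 0≤t ⟩
    (a i + a j) + t       ≈⟨ xy∙z≈zx∙y (a j) t (a i) ⟨
    (a j + t) + a i       ∎

  -- A translated sector a + S̄_i is never contained in c + S̄_k for i ≠ k:
  -- the raised points of a would give the upper bound a_k + c_i + t ≤ a_i + c_k
  -- for every t ≥ 0.
  sector-not-contained : ∀ {d} (a c : Pt d) {i k} → i ≢ k →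
                         ¬ (∀ x → Below a i x → Below c k x)
  sector-not-contained a c {i} {k} i≢k contained = unbounded (a k + c i) (a i + c k) bound
    where
    bound : ∀ t → 0# ≤ t → (a k + c i) + t ≤ a i + c k
    bound t 0≤t = begin
      (a k + c i) + t       ≈⟨ xy∙z≈xz∙y (a k) t (c i) ⟨
      (a k + t) + c i       ≡⟨ cong (_+ c i) (raise-off a t (λ k≡i → i≢k (sym k≡i))) ⟨
      raise a i t k + c i   ≤⟨ contained (raise a i t) (raise-Below a i 0≤t) i ⟩
      raise a i t i + c k   ≡⟨ cong (_+ c k) (raise-at a i t) ⟩
      a i + c k             ∎

  module Corner {n d} (V : Fin (suc n) → Pt d) (k : Fin d) where

    c : Pt d
    c = corner V k

    -- c_k = min_j (v_{j,k} - v_{j,k}) = 0.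
    corner-at-k : c k ≡ 0#
    corner-at-k = antisym
      (subst (c k ≤_) (-‿inverseʳ (V Fin.zero k)) (minF-lower (λ j → V j k - V j k) Fin.zero))
      (minF-greatest (λ j → V j k - V j k) (λ j → ≤-reflexive (sym (-‿inverseʳ (V j k)))))

    corner-∈-tconv : tconv V c
    corner-∈-tconv = (λ j → - V j k) , 0# , λ i → sym (+-identityʳ (c i))

    -- Every tropical combination M of V satisfies M_k + c_i ≤ M_i, because
    -- for each j, M_k + c_i ≤ (v_{j,k} + λ_j) + (v_{j,i} - v_{j,k}).
    combination-bound : ∀ (lam : Fin (suc n) → Carrier) i →
                        let M = ⨁ (λ j → lam j ⊙ V j) in M k + c i ≤ M i
    combination-bound lam i = minF-greatest _ λ j → begin
      minF (λ l → V l k + lam l) + c i     ≤⟨ +-mono (minF-lower _ j) (minF-lower _ j) ⟩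
      (V j k + lam j) + (V j i - V j k)    ≈⟨ cong (_+ (V j i - V j k)) (+-comm (V j k) (lam j)) ⟩
      (lam j + V j k) + (V j i - V j k)    ≈⟨ +-assoc (lam j) (V j k) (V j i - V j k) ⟩
      lam j + (V j k + (V j i - V j k))    ≈⟨ cong (lam j +_) (+-comm (V j k) (V j i - V j k)) ⟩
      lam j + ((V j i - V j k) + V j k)    ≈⟨ cong (lam j +_) (//-rightDividesˡ (V j k) (V j i)) ⟩
      lam j + V j i                        ≈⟨ +-comm (lam j) (V j i) ⟩
      V j i + lam j                        ∎

    tconv-Below : ∀ x → tconv V x → Below c k x
    tconv-Below x (lam , t , x≡M+t) = Below-shift t x≡M+t M-below
      where
      M : Pt d
      M = ⨁ (λ j → lam j ⊙ V j)
      M-below : Below c k M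
      M-below i = begin
        M k + c i   ≤⟨ combination-bound lam i ⟩
        M i         ≈⟨ +-identityʳ (M i) ⟨
        M i + 0#    ≡⟨ cong (M i +_) corner-at-k ⟨
        M i + c k   ∎

  module Minimal {e n} (V : Fin (suc n) → Pt (suc (suc e))) (k : Fin (suc (suc e))) where
    open Corner V k

    contains : tconv V ⊆ halfspace c ⁅ k ⁆
    contains x x∈tconv = Below⇒halfspace k (x∈⁅x⁆ k) (tconv-Below x x∈tconv)

    apex-sectors : ∀ a H → halfspace a H ⊆ halfspace c ⁅ k ⁆ → ∀ i → i ∈ H → i ≡ k
    apex-sectors a H inside i i∈H with i ≟ k
    ... | yes i≡k = i≡k
    ... | no i≢k  = ⊥-elim (sector-not-contained a c i≢k
                      λ x below → singleton⇒Below k (inside x (Below⇒halfspace i i∈H below)))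

    minimal : (a : Pt (suc (suc e))) (H : Subset (suc (suc e))) → ProperNonempty H →
              tconv V ⊆ halfspace a H → halfspace a H ⊆ halfspace c ⁅ k ⁆ →
              halfspace c ⁅ k ⁆ ⊆ halfspace a H
    minimal a H ((i , i∈H) , _) tconv⊆aH aH⊆cK x x∈cK =
      Below⇒halfspace k k∈H (Below-trans (singleton⇒Below k x∈cK) c-below)
      where
      onlyK : ∀ i → i ∈ H → i ≡ k
      onlyK = apex-sectors a H aH⊆cK
      k∈H : k ∈ H
      k∈H = subst (_∈ H) (onlyK i i∈H) i∈H
      c-below : Below a k c
      c-below with tconv⊆aH c corner-∈-tconv
      ... | (j , j∈H , inSector) = subst (λ l → Below a l c) (onlyK j j∈H) (sector⇒Below j inSector)

mainTheorem1 : (F : RealField) → let open Tropical F in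
    (e n : ℕ) (V : Fin (suc n) → Pt (suc (suc e))) (k : Fin (suc (suc e))) →
    ProperNonempty ⁅ k ⁆
    × tconv V ⊆ halfspace (corner V k) ⁅ k ⁆
    × ((a : Pt (suc (suc e))) (H : Subset (suc (suc e))) → ProperNonempty H →
       tconv V ⊆ halfspace a H →
       halfspace a H ⊆ halfspace (corner V k) ⁅ k ⁆ →
       halfspace (corner V k) ⁅ k ⁆ ⊆ halfspace a H)
mainTheorem1 F e n V k = singleton-proper k , contains , minimal
  where
  open Halfspaces F using (singleton-proper; module Minimal)
  open Minimal V k using (contains; minimal)
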